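{- Let $G$ be a graph of maximum degree $\Delta$ and let $\phi$ be a proper partial $(\Delta+1)$-edge-coloring of $G$. Then for every vertex $y \in V(G)$, we have $|R^{\leftarrow}(y,\phi)| \leq (\Delta+1)^3$.
   Context: A proper partial coloring is a map $\phi$ from a subset of $E(G)$ to $[\Delta+1]=\{1,\dots,\Delta+1\}$ such that adjacent edges (distinct edges sharing an endpoint) in its domain get distinct colors. For distinct colors $\alpha,\beta$, let $G(\phi,\alpha\beta)$ be the spanning subgraph of $G$ whose edges are those $e$ with $\phi(e) \in \{\alpha,\beta\}$ (its components are paths or cycles, isolated vertices counting as paths). For a vertex $x$, $\deg(x,\phi,\alpha\beta)$ is the degree of $x$ in $G(\phi,\alpha\beta)$; two vertices are $(\phi,\alpha\beta)$-related if they lie in the same connected component of $G(\phi,\alpha\beta)$. For $x \in V(G)$, $R^{\rightarrow}(x,\phi,\alpha\beta)$ is the set of vertices $y$ such that either $y = x$ or $y$ is adjacent to $x$, or there is a neighbor $z$ of $x$ with $\deg(z,\phi,\alpha\beta) < 2$ such that $z$ and $y$ are $(\phi,\alpha\beta)$-related. Let $R^{\leftarrow}(y,\phi,\alpha\beta) = \{x \in V(G) : y \in R^{\rightarrow}(x,\phi,\alpha\beta)\}$, and $R^{\leftarrow}(y,\phi) = \bigcup_{\alpha\neq\beta} R^{\leftarrow}(y,\phi,\alpha\beta)$, the union over all pairs of distinct colors in $[\Delta+1]$. -}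

module Defs where

open import Data.Nat using (ℕ; zero; suc; _≤_; _<_; _^_)
open import Data.Fin using (Fin; _≟_)
open import Data.Fin.Properties using ()
open import Data.Bool using (Bool; true; false; _∨_)
open import Data.Maybe using (Maybe; just; nothing)
open import Data.List using (List; length; filterᵇ)
open import Data.List using () renaming (allFin to allFinL)
open import Data.Product using (Σ; ∃; _×_; _,_)
open import Data.Sum using (_⊎_)
open import Function.Definitions using (Injective)
open import Relation.Nullary using (¬_; ⌊_⌋)
open import Relation.Binary.PropositionalEquality using (_≡_; _≢_)
open import Relation.Binary.Construct.Closure.ReflexiveTransitive using (Star)

record Graph : Set where
  field
    n      : ℕ
    adj    : Fin n → Fin n → Bool
    sym    : ∀ u v → adj u v ≡ adj v u
    irrefl : ∀ v → adj v v ≡ false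

open Graph public

Vertex : Graph → Set
Vertex G = Fin (n G)

Adj : (G : Graph) → Vertex G → Vertex G → Set
Adj G u v = adj G u v ≡ true

countᵇ : {m : ℕ} → (Fin m → Bool) → ℕ
countᵇ {m} p = length (filterᵇ p (allFinL m))

degree : (G : Graph) → Vertex G → ℕ
degree G v = countᵇ (adj G v)

-- G has maximum degree Δ (Δ = 0 for a graph without vertices)
MaxDegree : Graph → ℕ → Set
MaxDegree G Δ = (∀ v → degree G v ≤ Δ) × (Δ ≡ 0 ⊎ ∃ λ v → degree G v ≡ Δ)

-- Partial edge coloring with colors [k] = Fin k : each (unordered) edge uv
-- is either uncolored (nothing) or colored (just c); non-edges are uncolored.
record PartialColoring (G : Graph) (k : ℕ) : Set where
  field
    col     : Vertex G → Vertex G → Maybe (Fin k)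
    colSym  : ∀ u v → col u v ≡ col v u
    colEdge : ∀ u v c → col u v ≡ just c → Adj G u v

open PartialColoring public

Proper : {G : Graph} {k : ℕ} → PartialColoring G k → Set
Proper {G} φ = ∀ (u w w' : Vertex G) c →
  col φ u w ≡ just c → col φ u w' ≡ just c → w ≡ w'

inPair : {k : ℕ} → Fin k → Fin k → Maybe (Fin k) → Bool
inPair α β nothing  = false
inPair α β (just c) = ⌊ c ≟ α ⌋ ∨ ⌊ c ≟ β ⌋

EdgeAB : {G : Graph} {k : ℕ} → PartialColoring G k → Fin k → Fin k →
         Vertex G → Vertex G → Set
EdgeAB φ α β u v = inPair α β (col φ u v) ≡ true

degAB : {G : Graph} {k : ℕ} → PartialColoring G k → Fin k → Fin k → Vertex G → ℕ
degAB φ α β x = countᵇ (λ w → inPair α β (col φ x w))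

Related : {G : Graph} {k : ℕ} → PartialColoring G k → Fin k → Fin k →
          Vertex G → Vertex G → Set
Related φ α β = Star (EdgeAB φ α β)

-- y ∈ R→(x, φ, αβ)
Rfwd : {G : Graph} {k : ℕ} → PartialColoring G k → Fin k → Fin k →
       Vertex G → Vertex G → Set
Rfwd {G} φ α β x y =
  y ≡ x ⊎ Adj G x y ⊎
  (∃ λ z → Adj G x z × degAB φ α β z < 2 × Related φ α β z y)

-- x ∈ R←(y, φ) = ⋃_{α ≠ β} R←(y, φ, αβ)
Rback : {G : Graph} {k : ℕ} → PartialColoring G k → Vertex G → Vertex G → Set
Rback φ y x = ∃ λ α → ∃ λ β → α ≢ β × Rfwd φ α β x y

CardAtMost : {m : ℕ} → (Fin m → Set) → ℕ → Set
CardAtMost {m} P b = ∀ (s : ℕ) (f : Fin s → Fin m) →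
  Injective _≡_ _≡_ f → (∀ i → P (f i)) → s ≤ b

module Submission where

-- Fix y.  We encode every x ∈ R←(y,φ) injectively by a triple
-- of colours, i.e. an element of [Δ+1]³, which gives |R←(y,φ)| ≤ (Δ+1)³:
--   * x = y            ↦ (0, 0, 0);
--   * x adjacent to y  ↦ (0, 0, 1+i), i < Δ the position of x among the
--                        neighbours of y;
--   * otherwise x has a neighbour z with deg(z,φ,αβ) < 2 lying in the
--     αβ-component of y, for some α ≠ β.  Then z is the last vertex of the
--     walk from y that follows the colours c, d, c, d, … for one of the
--     orders (c,d) of {α,β}; we map x ↦ (c, d, i), i the position of x among
--     the neighbours of z.  The pair (c,d) determines z, and c ≠ d separates
--     this case from the first two.

open import Defs hiding (sym)
open import Data.Nat using (ℕ; zero; suc; _≤_; _<_; _^_; z≤n; s≤s)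
open import Data.Nat.Properties using (m≤n⇒m≤1+n; <⇒≱; <-cmp; m≤n⇒m<n∨m≡n)
open import Data.Fin using (Fin; _≟_; inject≤; inject₁; combine)
open import Data.Fin.Properties
  using (any?; inject≤-injective; inject₁-injective; suc-injective; combine-injective; injective⇒≤)
open import Data.Bool using (Bool; true; T; T?)
open import Data.Bool.Properties using (∨-zeroʳ)
open import Data.Unit using (tt)
open import Data.Maybe using (Maybe; just; nothing; _>>=_)
open import Data.Maybe.Properties using (just-injective; ≡-dec)
open import Data.List using (List; length; lookup; filterᵇ)
open import Data.List using () renaming (allFin to allFinL)
open import Data.List.Relation.Unary.Any using (here; there; index)
open import Data.List.Relation.Unary.Any.Properties using (lookup-index)
open import Data.List.Membership.Propositional using (_∈_)
open import Data.List.Membership.Propositional.Properties using (∈-allFin; ∈-filter⁺)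
open import Data.Product using (Σ; ∃; _×_; _,_)
open import Data.Sum using (_⊎_; inj₁; inj₂; swap; [_,_])
open import Data.Empty using (⊥-elim)
open import Function using (_∘_)
open import Relation.Nullary using (yes; no)
open import Relation.Binary.PropositionalEquality
  using (_≡_; _≢_; refl; sym; trans; cong; subst; ≡-≟-identity; module ≡-Reasoning)
open import Relation.Binary.Definitions using (tri<; tri≈; tri>)
open import Relation.Binary.Construct.Closure.ReflexiveTransitive using (ε; _◅_)

module _ {A : Set} where

  nonempty : {x : A} {ys : List A} → x ∈ ys → 1 ≤ length ys
  nonempty (here _)  = s≤s z≤n
  nonempty (there _) = s≤s z≤n

  length-≥2 : {x x' : A} {ys : List A} → x ∈ ys → x' ∈ ys → x ≢ x' → 2 ≤ length ys
  length-≥2 (here p)  (here q)  x≢x' = ⊥-elim (x≢x' (trans p (sym q)))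
  length-≥2 (here _)  (there q) _    = s≤s (nonempty q)
  length-≥2 (there p) (here _)  _    = s≤s (nonempty p)
  length-≥2 (there p) (there q) x≢x' = m≤n⇒m≤1+n (length-≥2 p q x≢x')

  position : {b : ℕ} {x : A} {xs : List A} → length xs ≤ b → x ∈ xs → Fin b
  position bound x∈xs = inject≤ (index x∈xs) bound

  position-injective : {b : ℕ} {x x' : A} {xs : List A} (bound : length xs ≤ b)
    (p : x ∈ xs) (p' : x' ∈ xs) → position bound p ≡ position bound p' → x ≡ x'
  position-injective {xs = xs} bound p p' eq = begin
    _                   ≡⟨ lookup-index p ⟩
    lookup xs (index p)  ≡⟨ cong (lookup xs) (inject≤-injective bound bound _ _ eq) ⟩
    lookup xs (index p') ≡⟨ sym (lookup-index p') ⟩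
    _                   ∎
    where open ≡-Reasoning

∈-filterᵇ : {m : ℕ} (p : Fin m → Bool) {i : Fin m} → p i ≡ true → i ∈ filterᵇ p (allFinL m)
∈-filterᵇ p {i} pi≡true = ∈-filter⁺ (T? ∘ p) (∈-allFin i) (subst T (sym pi≡true) tt)

countᵇ-≥2 : {m : ℕ} (p : Fin m → Bool) {i j : Fin m} → i ≢ j →
  p i ≡ true → p j ≡ true → 2 ≤ countᵇ p
countᵇ-≥2 p i≢j pi pj = length-≥2 (∈-filterᵇ p pi) (∈-filterᵇ p pj) i≢j

-- Triples over Fin m embed injectively into Fin (m ^ 3).
-- (Opaque, so that triple-injective can infer the components from an equation.)
opaque
  triple : {m : ℕ} → Fin m → Fin m → Fin m → Fin (m ^ 3)
  triple a b c = combine a (combine b (combine c Fin.zero))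

  triple-injective : {m : ℕ} {a b c a' b' c' : Fin m} →
    triple a b c ≡ triple a' b' c' → a ≡ a' × b ≡ b' × c ≡ c'
  triple-injective {a = a} {b} {c} {a'} {b'} {c'} eq
    with refl , eq₁ ← combine-injective a _ a' _ eq
    with refl , eq₂ ← combine-injective b _ b' _ eq₁
    with refl , _   ← combine-injective c _ c' _ eq₂
    = refl , refl , refl

card-by-code : {m b : ℕ} {P : Fin m → Set} (code : ∀ x → P x → Fin b) →
  (∀ {x x'} (p : P x) (p' : P x') → code x p ≡ code x' p' → x ≡ x') →
  CardAtMost P b
card-by-code code code-injective s f f-injective inP =
  injective⇒≤ {f = λ i → code (f i) (inP i)}
    (λ {i} {j} eq → f-injective (code-injective (inP i) (inP j) eq))

adj-sym : {G : Graph} {u v : Vertex G} → Adj G u v → Adj G v u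
adj-sym {G} {u} {v} a = trans (Graph.sym G v u) a

nbrIndex : (G : Graph) {Δ : ℕ} → (∀ v → degree G v ≤ Δ) →
  (z x : Vertex G) → Adj G z x → Fin Δ
nbrIndex G bounded z x a = position (bounded z) (∈-filterᵇ (adj G z) a)

nbrIndex-injective : (G : Graph) {Δ : ℕ} (bounded : ∀ v → degree G v ≤ Δ)
  {z x x' : Vertex G} (a : Adj G z x) (a' : Adj G z x') →
  nbrIndex G bounded z x a ≡ nbrIndex G bounded z x' a' → x ≡ x'
nbrIndex-injective G bounded {z} a a' =
  position-injective (bounded z) (∈-filterᵇ (adj G z) a) (∈-filterᵇ (adj G z) a')

module _ {k : ℕ} {α β : Fin k} where

  inPair-complete : {c : Fin k} → c ≡ α ⊎ c ≡ β → inPair α β (just c) ≡ true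
  inPair-complete (inj₁ refl) rewrite ≡-≟-identity _≟_ (refl {x = α}) = refl
  inPair-complete (inj₂ refl) rewrite ≡-≟-identity _≟_ (refl {x = β}) = ∨-zeroʳ _

  inPair-sound : (m : Maybe (Fin k)) → inPair α β m ≡ true →
    ∃ λ c → m ≡ just c × (c ≡ α ⊎ c ≡ β)
  inPair-sound nothing  ()
  inPair-sound (just c) h with c ≟ α | c ≟ β
  ... | yes c≡α | _       = c , refl , inj₁ c≡α
  ... | no _    | yes c≡β = c , refl , inj₂ c≡β
  inPair-sound (just c) () | no _ | no _

alt : {A : Set} → A → A → ℕ → A
alt c d zero    = c
alt c d (suc k) = alt d c k

alt-other : {A : Set} {c d e : A} (k : ℕ) → e ≡ c ⊎ e ≡ d → e ≢ alt c d k → e ≡ alt d c k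
alt-other zero    (inj₁ e≡c) e≢c = ⊥-elim (e≢c e≡c)
alt-other zero    (inj₂ e≡d) _   = e≡d
alt-other (suc k) e∈cd       e≢  = alt-other k (swap e∈cd) e≢

module ProperColouring {G : Graph} {k : ℕ} (φ : PartialColoring G k) (proper : Proper φ) where

  V : Set
  V = Vertex G

  C : Set
  C = Fin k

  -- next v c: the (unique, by properness) neighbour w of v with φ(vw) = c.
  next : V → C → Maybe V
  next v c with any? (λ w → ≡-dec _≟_ (col φ v w) (just c))
  ... | yes (w , _) = just w
  ... | no _        = nothing

  next-sound : ∀ {v c w} → next v c ≡ just w → col φ v w ≡ just c
  next-sound {v} {c} eq with any? (λ w → ≡-dec _≟_ (col φ v w) (just c))
  next-sound refl | yes (_ , h) = h
  next-sound ()   | no _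

  next-absent : ∀ {v c w} → next v c ≡ nothing → col φ v w ≢ just c
  next-absent {v} {c} eq h with any? (λ w → ≡-dec _≟_ (col φ v w) (just c))
  next-absent () h | yes _
  next-absent eq h | no none = none (_ , h)

  next-complete : ∀ {v c w} → col φ v w ≡ just c → next v c ≡ just w
  next-complete {v} {c} h with any? (λ w → ≡-dec _≟_ (col φ v w) (just c))
  ... | yes (w' , h') = cong just (proper v w' _ c h' h)
  ... | no none       = ⊥-elim (none (_ , h))

  edgeAB-sym : ∀ {α β u v} → EdgeAB φ α β u v → EdgeAB φ α β v u
  edgeAB-sym {u = u} {v} h rewrite colSym φ v u = h

  missing-colour : ∀ {α β z} → α ≢ β → degAB φ α β z < 2 →
    ∃ λ m → (m ≡ α ⊎ m ≡ β) × next z m ≡ nothing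
  missing-colour {α} {β} {z} α≢β low with next z α in eα | next z β in eβ
  ... | nothing | _       = α , inj₁ refl , eα
  ... | just _  | nothing = β , inj₂ refl , eβ
  ... | just wα | just wβ =
    ⊥-elim (<⇒≱ low (countᵇ-≥2 _ wα≢wβ (edge (next-sound eα) (inj₁ refl))
                                        (edge (next-sound eβ) (inj₂ refl))))
    where
      wα≢wβ : wα ≢ wβ
      wα≢wβ refl = α≢β (just-injective (trans (sym (next-sound eα)) (next-sound eβ)))
      edge : ∀ {w c} → col φ z w ≡ just c → c ≡ α ⊎ c ≡ β → inPair α β (col φ z w) ≡ true
      edge h c∈αβ rewrite h = inPair-complete c∈αβ

module AlternatingWalks {G : Graph} {k : ℕ} (φ : PartialColoring G k)
                        (proper : Proper φ) (y : Vertex G) where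

  open ProperColouring φ proper public

  walk : C → C → ℕ → Maybe V
  walk c d zero    = just y
  walk c d (suc j) = walk c d j >>= λ v → next v (alt c d j)

  walk-forward : ∀ {c d j a w} → walk c d j ≡ just a → col φ a w ≡ just (alt c d j) →
    walk c d (suc j) ≡ just w
  walk-forward sj h rewrite sj = next-complete h

  walk-stop : ∀ {c d j a} → walk c d j ≡ just a → next a (alt c d j) ≡ nothing →
    walk c d (suc j) ≡ nothing
  walk-stop sj none rewrite sj = none

  walk-previous : ∀ {c d j a} → walk c d (suc j) ≡ just a →
    ∃ λ a₀ → walk c d j ≡ just a₀ × col φ a a₀ ≡ just (alt c d j)
  walk-previous {c} {d} {j} eq with walk c d j
  ... | just a₀ = a₀ , refl , trans (colSym φ _ a₀) (next-sound eq)
  walk-previous () | nothing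

  walk-stopped : ∀ {c d j} → walk c d (suc j) ≡ nothing → ∀ i → j < i → walk c d i ≡ nothing
  walk-stopped stop (suc i) (s≤s j≤i) with m≤n⇒m<n∨m≡n j≤i
  ... | inj₂ refl = stop
  ... | inj₁ j<i rewrite walk-stopped stop i j<i = refl

  OnWalk : C → C → V → Set
  OnWalk c d w = ∃ λ j → walk c d j ≡ just w

  Terminal : C → C → V → Set
  Terminal c d z = ∃ λ j → walk c d j ≡ just z × walk c d (suc j) ≡ nothing

  terminal-unique : ∀ {c d z z'} → Terminal c d z → Terminal c d z' → z ≡ z'
  terminal-unique (j , sj , stop) (j' , sj' , stop') with <-cmp j j'
  ... | tri< j<j' _ _ with () ← trans (sym sj') (walk-stopped stop j' j<j')
  ... | tri≈ _ refl _ = just-injective (trans (sym sj) sj')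
  ... | tri> _ _ j'<j with () ← trans (sym sj) (walk-stopped stop' j j'<j)

  walk-turn : ∀ {c d e a} j → e ≡ c ⊎ e ≡ d → e ≢ alt c d j → walk c d j ≡ just a →
    (walk d c 0 ≡ just a × e ≡ alt d c 0) ⊎
    (∃ λ a₀ → ∃ λ i → walk c d i ≡ just a₀ × col φ a a₀ ≡ just e)
  walk-turn zero e∈cd e≢ sj = inj₁ (sj , alt-other 0 e∈cd e≢)
  walk-turn {c} {d} (suc j) e∈cd e≢ sj with walk-previous {c} {d} {j} sj
  ... | a₀ , sj₀ , h = inj₂ (a₀ , j , sj₀ , trans h (cong just (sym (alt-other (suc j) e∈cd e≢))))

  walk-step : ∀ {c d a w e} → OnWalk c d a → col φ a w ≡ just e → e ≡ c ⊎ e ≡ d →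
    OnWalk c d w ⊎ OnWalk d c w
  walk-step {c} {d} {a} {w} {e} (j , sj) h e∈cd with e ≟ alt c d j
  ... | yes refl = inj₁ (suc j , walk-forward {c} {d} {j} sj h)
  ... | no e≢ with walk-turn j e∈cd e≢ sj
  ...   | inj₁ (s₀ , refl) = inj₂ (1 , walk-forward {d} {c} {0} s₀ h)
  ...   | inj₂ (a₀ , i , si , h₀) = inj₁ (i , subst (λ v → walk c d i ≡ just v) (proper a a₀ w e h₀ h) si)

  walk-end : ∀ {c d m z} → OnWalk c d z → m ≡ c ⊎ m ≡ d → next z m ≡ nothing →
    Terminal c d z ⊎ Terminal d c z
  walk-end {c} {d} {m} (j , sj) m∈cd none with m ≟ alt c d j
  ... | yes refl = inj₁ (j , sj , walk-stop {c} {d} {j} sj none)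
  ... | no m≢ with walk-turn j m∈cd m≢ sj
  ...   | inj₁ (s₀ , refl) = inj₂ (0 , s₀ , walk-stop {d} {c} {0} s₀ none)
  ...   | inj₂ (_ , _ , _ , h) = ⊥-elim (next-absent none h)

  -- The αβ-component of y is covered by the (α,β)- and (β,α)-walks.
  Covered : C → C → V → Set
  Covered α β w = OnWalk α β w ⊎ OnWalk β α w

  covered-step : ∀ {α β a w} → EdgeAB φ α β a w → Covered α β a → Covered α β w
  covered-step {a = a} {w} h with inPair-sound (col φ a w) h
  ... | e , ce , e∈αβ = [ (λ on → walk-step on ce e∈αβ) , (λ on → swap (walk-step on ce (swap e∈αβ))) ]

  related-covered : ∀ {α β z} → Related φ α β z y → Covered α β z
  related-covered ε       = inj₁ (0 , refl)
  related-covered (e ◅ r) = covered-step (edgeAB-sym e) (related-covered r)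

  End : V → Set
  End z = Σ C λ c → Σ C λ d → c ≢ d × Terminal c d z

  orient : ∀ {α β z} → α ≢ β → Terminal α β z ⊎ Terminal β α z → End z
  orient {α} {β} α≢β = [ (λ t → α , β , α≢β , t) , (λ t → β , α , α≢β ∘ sym , t) ]

  low-degree-end : ∀ {α β z} → α ≢ β → Related φ α β z y → degAB φ α β z < 2 → End z
  low-degree-end α≢β r low with missing-colour α≢β low | related-covered r
  ... | m , m∈αβ , none | inj₁ on = orient α≢β (walk-end on m∈αβ none)
  ... | m , m∈αβ , none | inj₂ on = orient α≢β (swap (walk-end on (swap m∈αβ) none))

module Encoding (G : Graph) {Δ : ℕ} (bounded : ∀ v → degree G v ≤ Δ)
                (φ : PartialColoring G (suc Δ)) (proper : Proper φ) (y : Vertex G) where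

  open AlternatingWalks φ proper y

  Near : V → Set
  Near x = x ≡ y ⊎ Adj G y x

  Far : V → Set
  Far x = ∃ λ z → End z × Adj G z x

  -- Every x ∈ R←(y,φ) is near or far: its witness z has low αβ-degree and
  -- lies in the αβ-component of y, hence is an end.
  classify : ∀ {x} → Rback φ y x → Near x ⊎ Far x
  classify (α , β , α≢β , inj₁ y≡x)                     = inj₁ (inj₁ (sym y≡x))
  classify (α , β , α≢β , inj₂ (inj₁ a))                = inj₁ (inj₂ (adj-sym {G} a))
  classify (α , β , α≢β , inj₂ (inj₂ (z , a , low , r))) = inj₂ (z , low-degree-end α≢β r low , adj-sym {G} a)

  near-index : ∀ {x} → Near x → C
  near-index (inj₁ _) = Fin.zero
  near-index {x} (inj₂ a) = Fin.suc (nbrIndex G bounded y x a)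

  near-index-injective : ∀ {x x'} (p : Near x) (p' : Near x') → near-index p ≡ near-index p' → x ≡ x'
  near-index-injective (inj₁ x≡y) (inj₁ x'≡y) _  = trans x≡y (sym x'≡y)
  near-index-injective (inj₂ a)   (inj₂ a')   eq = nbrIndex-injective G bounded a a' (suc-injective eq)
  near-index-injective (inj₁ _)   (inj₂ _)    ()
  near-index-injective (inj₂ _)   (inj₁ _)    ()

  code : ∀ {x} → Near x ⊎ Far x → Fin (suc Δ ^ 3)
  code (inj₁ p)                          = triple Fin.zero Fin.zero (near-index p)
  code {x} (inj₂ (z , (c , d , _ , _) , a)) = triple c d (inject₁ (nbrIndex G bounded z x a))

  -- Near and far codes differ in whether the first two colours coincide;
  -- among far codes (c,d) determines the end z (terminal-unique).
  code-injective : ∀ {x x'} (p : Near x ⊎ Far x) (p' : Near x' ⊎ Far x') → code p ≡ code p' → x ≡ x'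
  code-injective (inj₁ p) (inj₁ p') eq with _ , _ , i≡i' ← triple-injective eq =
    near-index-injective p p' i≡i'
  code-injective (inj₁ _) (inj₂ (_ , (_ , _ , c≢d , _) , _)) eq with 0≡c , 0≡d , _ ← triple-injective eq =
    ⊥-elim (c≢d (trans (sym 0≡c) 0≡d))
  code-injective (inj₂ (_ , (_ , _ , c≢d , _) , _)) (inj₁ _) eq with c≡0 , d≡0 , _ ← triple-injective eq =
    ⊥-elim (c≢d (trans c≡0 (sym d≡0)))
  code-injective (inj₂ (_ , (_ , _ , _ , t) , a)) (inj₂ (_ , (_ , _ , _ , t') , a')) eq
    with refl , refl , i≡i' ← triple-injective eq
    with refl ← terminal-unique t t' =
    nbrIndex-injective G bounded a a' (inject₁-injective i≡i')

lemma5p1 : (G : Graph) (Δ : ℕ) → MaxDegree G Δ →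
    (φ : PartialColoring G (suc Δ)) → Proper φ →
    ∀ (y : Vertex G) → CardAtMost (Rback φ y) (suc Δ ^ 3)
lemma5p1 G Δ (bounded , _) φ proper y =
  card-by-code (λ _ p → code (classify p))
               (λ p p' eq → code-injective (classify p) (classify p') eq)
  where open Encoding G bounded φ proper y
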